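{- Let $G=(V,E)$ be a graph with a smooth tree-decomposition $(X,T)$ of width $k$, let $C=\{1,\dots,c\}$, and let $X_i$ be an internal node of $T$ with children $X_L,X_R$, where $X_L=X_i$, $X_i\setminus X_R=\{v'\}$ and $X_R\setminus X_i=\{v''\}$. Let $f:E_i'\to C$ be a partial coloring of $G_i'$, $f_L=f|_{E_L'}$, $f_R=f|_{E_R'}$, and let $CL_f$, $CL_{f_L}$, $CL_{f_R}$ be the color class functions on $X_i$, $X_L$, $X_R$ respectively. Then for every $(A^{(j)})_{1\le j\le 9}\in\mathcal S(X_i)$, $$CL_f\big((A^{(j)})_{j}\big)=\bigcup\Big(CL_{f_L}\big((A_L^{(j)})_{j}\big)\cap CL_{f_R}\big((A_R^{(j)})_{j}\big)\Big),$$ where the union is over all $(A_L^{(j)})_{j}\in\mathcal S(X_L)$ and $(A_R^{(j)})_{j}\in\mathcal S(X_R)$ such that $A^{(j)}=\big(A_L^{(j)}\cup A_R^{(j)}\cup\bar A^{(j)}\big)-\{v''\}$ for all $1\le j\le 9$ (with $\bar A^{(j)}$ computed from $(A_L^{(j)})_j,(A_R^{(j)})_j$ as in the context, and, for $j\in\{3,8,9\}$, "$-\{v''\}$" meaning removal of all pairs having $v''$ as a coordinate).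
   Context: Tree-decomposition: a pair $(X,T)$, $T$ a tree with node set $I$, $X=\{X_i:i\in I\}$ subsets of $V$ with $\bigcup X_i=V$, every edge having both ends in some $X_i$, and $X_i\cap X_s\subseteq X_j$ whenever $j$ is on the $T$-path from $i$ to $s$. It is smooth of width $k$ if $T$ is a binary tree, $|X_i|=k+1$ for all $i$, every internal node has exactly two children one of which has the same bag as the node, $k\le|X_i\cap X_j|\le k+1$ for every tree edge $ij$, and every edge has both ends in the bag of at least one leaf. For each edge $e$ choose a leaf $rep(e)$ whose bag contains both ends of $e$. For a leaf $X_i$: $V_i=X_i$, $E_i'=\{e: rep(e)=i\}$; for an internal node with children $X_L,X_R$: $V_i=V_L\cup V_R$, $E_i'=E_L'\cup E_R'$. $G_i'=(V_i,E_i')$; a partial coloring of $G_i'$ is any map $f:E_i'\to C$. For a partial coloring $f$ of $G_i'$ and $(c_1,c_2)\in C^2$ define (edges in $E_i'$): $N^{(1)}_f(c_1,c_2)=\{v_0\in X_i:\exists v_0v_1,v_1v_2,\ f(v_0v_1)=c_1,f(v_1v_2)=c_2\}$; $N^{(2)}_f(c_1,c_2)=\{v_0\in X_i:\exists v_0v_1,v_1v_2,\ f(v_0v_1)=c_2,f(v_1v_2)=c_1\}$; $N^{(3)}_f(c_1,c_2)=\{(v_0,v_2)\in X_i^2:\exists v_0v_1,v_1v_2,\ f(v_0v_1)=c_1,f(v_1v_2)=c_2\}$; $N^{(4)}_f(c_1,c_2)=\{v_0\in X_i:\exists v_0v_1,v_1v_2,v_2v_3,\ f(v_0v_1)=c_1,f(v_1v_2)=c_2,f(v_2v_3)=c_1\}$;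 $N^{(5)}_f(c_1,c_2)=\{v_0\in X_i:\exists v_0v_1,v_1v_2,v_2v_3,\ f(v_0v_1)=c_2,f(v_1v_2)=c_1,f(v_2v_3)=c_2\}$; $N^{(6)}_f(c_1,c_2)=\{v_0\in X_i:\exists v_0v,\ f(v_0v)=c_1\}$; $N^{(7)}_f(c_1,c_2)=\{v_0\in X_i:\exists v_0v,\ f(v_0v)=c_2\}$; $N^{(8)}_f(c_1,c_2)=\{(v_0,v_1)\in X_i^2: v_0v_1\in E_i',f(v_0v_1)=c_1\}$; $N^{(9)}_f(c_1,c_2)=\{(v_0,v_1)\in X_i^2: v_0v_1\in E_i',f(v_0v_1)=c_2\}$. $\mathcal S(X_i)$ is the set of 9-tuples $(A^{(1)},\dots,A^{(9)})$ with $A^{(j)}\subseteq X_i$ for $j\in\{1,2,4,5,6,7\}$ and $A^{(j)}\subseteq X_i^2$ for $j\in\{3,8,9\}$. The color class function of $f$ on $X_i$ is $CL_f:\mathcal S(X_i)\to 2^{C^2}$, $CL_f((A^{(j)})_j)=\{(c_1,c_2)\in C^2: A^{(j)}=N^{(j)}_f(c_1,c_2)\text{ for all }1\le j\le 9\}$; $CL_{f_L}$ and $CL_{f_R}$ are defined likewise with $G_L',X_L$ and $G_R',X_R$. Given tuples $(A_L^{(j)})_j,(A_R^{(j)})_j$, define: $\bar A^{(1)}=\{v_0:(v_0,v_1)\in A_L^{(8)},v_1\in A_R^{(7)}\}\cup\{v_0:(v_0,v_1)\in A_R^{(8)},v_1\in A_L^{(7)}\}$; $\bar A^{(2)}=\{v_0:(v_0,v_1)\in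 A_L^{(9)},v_1\in A_R^{(6)}\}\cup\{v_0:(v_0,v_1)\in A_R^{(9)},v_1\in A_L^{(6)}\}$; $\bar A^{(3)}=\{(v_1,v_2):\exists v_3,(v_1,v_3)\in A_L^{(8)},(v_3,v_2)\in A_R^{(9)}\}\cup\{(v_1,v_2):\exists v_3,(v_1,v_3)\in A_R^{(8)},(v_3,v_2)\in A_L^{(9)}\}$; $\bar A^{(4)}$ is the union of $\{v_0:\exists v_1,(v_0,v_1)\in A_L^{(3)},v_1\in A_R^{(6)}\}$, $\{v_0:\exists v_1,v_2,(v_0,v_1)\in A_L^{(8)},(v_1,v_2)\in A_R^{(9)},v_2\in A_L^{(6)}\}$, $\{v_0:\exists v_1,(v_0,v_1)\in A_L^{(8)},v_1\in A_R^{(2)}\}$ and the three sets obtained by interchanging $L$ and $R$; $\bar A^{(5)}$ is the union of $\{v_0:\exists v_1,(v_1,v_0)\in A_L^{(3)},v_1\in A_R^{(7)}\}$, $\{v_0:\exists v_1,v_2,(v_0,v_1)\in A_L^{(9)},(v_1,v_2)\in A_R^{(8)},v_2\in A_L^{(7)}\}$, $\{v_0:\exists v_1,(v_0,v_1)\in A_L^{(9)},v_1\in A_R^{(1)}\}$ and the three sets obtained by interchanging $L$ and $R$; $\bar A^{(j)}=\emptyset$ for $6\le j\le 9$. -}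

module Defs where

open import Data.Nat using (ℕ; suc; _≤_)
open import Data.Fin using (Fin)
open import Data.Fin.Subset using (Subset; _∈_; _∉_; _⊆_; _∩_; ∣_∣)
open import Data.Bool using (Bool; true; false)
open import Data.Vec using (Vec; lookup)
open import Data.Product using (Σ; ∃; ∃₂; _×_; _,_; proj₁; proj₂)
open import Data.Sum using (_⊎_)
open import Data.Empty using (⊥)
open import Data.Unit using (⊤)
open import Relation.Nullary using (¬_)
open import Relation.Binary.PropositionalEquality using (_≡_; _≢_)
open import Function.Bundles using (_⇔_)

record Graph (n : ℕ) : Set where
  field
    adj    : Fin n → Fin n → Bool
    sym    : ∀ u v → adj u v ≡ adj v u
    irrefl : ∀ v → adj v v ≡ false
open Graph public

IsEdge : ∀ {n} → Graph n → Fin n → Fin n → Set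
IsEdge G u v = adj G u v ≡ true

data Tree (n : ℕ) : Set where
  leaf : Subset n → Tree n
  node : Subset n → Tree n → Tree n → Tree n

root : ∀ {n} → Tree n → Subset n
root (leaf X)     = X
root (node X _ _) = X

-- s ⊑ t : an occurrence of the subtree s inside t (i.e. a node of t)
data _⊑_ {n : ℕ} : Tree n → Tree n → Set where
  here : ∀ {t} → t ⊑ t
  inL  : ∀ {s X l r} → s ⊑ l → s ⊑ node X l r
  inR  : ∀ {s X l r} → s ⊑ r → s ⊑ node X l r

⊑-trans : ∀ {n} {s m t : Tree n} → s ⊑ m → m ⊑ t → s ⊑ t
⊑-trans p here    = p
⊑-trans p (inL q) = inL (⊑-trans p q)
⊑-trans p (inR q) = inR (⊑-trans p q)

Node : ∀ {n} → Tree n → Set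
Node {n} t = Σ (Tree n) (λ s → s ⊑ t)

bag : ∀ {n} {t : Tree n} → Node t → Subset n
bag (s , _) = root s

IsLeafTree : ∀ {n} → Tree n → Set
IsLeafTree (leaf _)     = ⊤
IsLeafTree (node _ _ _) = ⊥

IsLeaf : ∀ {n} {t : Tree n} → Node t → Set
IsLeaf (s , _) = IsLeafTree s

childL : ∀ {n} {t : Tree n} {X l r} → node X l r ⊑ t → l ⊑ t
childL w = ⊑-trans (inL here) w

childR : ∀ {n} {t : Tree n} {X l r} → node X l r ⊑ t → r ⊑ t
childR w = ⊑-trans (inR here) w

_≼_ : ∀ {n} {t : Tree n} → Node t → Node t → Set
(a , wa) ≼ (b , wb) = Σ (b ⊑ a) (λ o → ⊑-trans o wa ≡ wb)

-- j lies on the T-path from i to s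
OnPath : ∀ {n} {t : Tree n} → Node t → Node t → Node t → Set
OnPath {t = t} i s j = (j ≼ i ⊎ j ≼ s) × (∀ (a : Node t) → a ≼ i → a ≼ s → a ≼ j)

record IsTreeDecomposition {n} (G : Graph n) (t : Tree n) : Set where
  field
    cover : ∀ (v : Fin n) → ∃ λ (i : Node t) → v ∈ bag i
    edges : ∀ (u v : Fin n) → IsEdge G u v → ∃ λ (i : Node t) → u ∈ bag i × v ∈ bag i
    path  : ∀ (i s j : Node t) → OnPath i s j → (bag i ∩ bag s) ⊆ bag j

record IsSmooth {n} (k : ℕ) (G : Graph n) (t : Tree n) : Set where
  field
    bagSize  : ∀ (i : Node t) → ∣ bag i ∣ ≡ suc k
    sameBag  : ∀ {X l r} → node X l r ⊑ t → root l ≡ X ⊎ root r ≡ X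
    edgeL    : ∀ {X l r} → node X l r ⊑ t → k ≤ ∣ X ∩ root l ∣ × ∣ X ∩ root l ∣ ≤ suc k
    edgeR    : ∀ {X l r} → node X l r ⊑ t → k ≤ ∣ X ∩ root r ∣ × ∣ X ∩ root r ∣ ≤ suc k
    leafEdge : ∀ (u v : Fin n) → IsEdge G u v →
               ∃ λ (i : Node t) → IsLeaf i × u ∈ bag i × v ∈ bag i

-- A choice of rep(e) for every edge e = uv (values on non-edges are irrelevant)
record Rep {n} (G : Graph n) (t : Tree n) : Set where
  field
    rep     : Fin n → Fin n → Node t
    repLeaf : ∀ u v → IsEdge G u v → IsLeaf (rep u v)
    repBag  : ∀ u v → IsEdge G u v → u ∈ bag (rep u v) × v ∈ bag (rep u v)
    repSym  : ∀ u v → IsEdge G u v → rep u v ≡ rep v u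
open Rep public

E' : ∀ {n} {G : Graph n} {t : Tree n} → Rep G t →
     (s : Tree n) → s ⊑ t → Fin n → Fin n → Set
E' {G = G} ρ (leaf X) w u v = IsEdge G u v × rep ρ u v ≡ (leaf X , w)
E' ρ (node X l r) w u v = E' ρ l (⊑-trans (inL here) w) u v ⊎ E' ρ r (⊑-trans (inR here) w) u v

PairSet : ℕ → Set
PairSet n = Vec (Subset n) n

_∈₂_ : ∀ {n} → Fin n × Fin n → PairSet n → Set
(u , w) ∈₂ R = w ∈ lookup R u

record Tuple (n : ℕ) : Set where
  constructor tuple
  field
    a1 a2 : Subset n
    a3    : PairSet n
    a4 a5 a6 a7 : Subset n
    a8 a9 : PairSet n
open Tuple public

PairsIn : ∀ {n} → PairSet n → Subset n → Set
PairsIn R X = ∀ u w → (u , w) ∈₂ R → u ∈ X × w ∈ X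

InS : ∀ {n} → Subset n → Tuple n → Set
InS X A = a1 A ⊆ X × a2 A ⊆ X × PairsIn (a3 A) X × a4 A ⊆ X × a5 A ⊆ X ×
          a6 A ⊆ X × a7 A ⊆ X × PairsIn (a8 A) X × PairsIn (a9 A) X

module _ {n c : ℕ} (X : Subset n) (Ed : Fin n → Fin n → Set)
         (f : Fin n → Fin n → Fin c) (c1 c2 : Fin c) where

  N1 : Fin n → Set
  N1 v0 = v0 ∈ X × ∃₂ λ v1 v2 → Ed v0 v1 × Ed v1 v2 × f v0 v1 ≡ c1 × f v1 v2 ≡ c2

  N2 : Fin n → Set
  N2 v0 = v0 ∈ X × ∃₂ λ v1 v2 → Ed v0 v1 × Ed v1 v2 × f v0 v1 ≡ c2 × f v1 v2 ≡ c1

  N3 : Fin n → Fin n → Set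
  N3 v0 v2 = v0 ∈ X × v2 ∈ X × ∃ λ v1 → Ed v0 v1 × Ed v1 v2 × f v0 v1 ≡ c1 × f v1 v2 ≡ c2

  N4 : Fin n → Set
  N4 v0 = v0 ∈ X × ∃₂ λ v1 v2 → ∃ λ v3 → Ed v0 v1 × Ed v1 v2 × Ed v2 v3 ×
            f v0 v1 ≡ c1 × f v1 v2 ≡ c2 × f v2 v3 ≡ c1

  N5 : Fin n → Set
  N5 v0 = v0 ∈ X × ∃₂ λ v1 v2 → ∃ λ v3 → Ed v0 v1 × Ed v1 v2 × Ed v2 v3 ×
            f v0 v1 ≡ c2 × f v1 v2 ≡ c1 × f v2 v3 ≡ c2

  N6 : Fin n → Set
  N6 v0 = v0 ∈ X × ∃ λ v → Ed v0 v × f v0 v ≡ c1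

  N7 : Fin n → Set
  N7 v0 = v0 ∈ X × ∃ λ v → Ed v0 v × f v0 v ≡ c2

  N8 : Fin n → Fin n → Set
  N8 v0 v1 = v0 ∈ X × v1 ∈ X × Ed v0 v1 × f v0 v1 ≡ c1

  N9 : Fin n → Fin n → Set
  N9 v0 v1 = v0 ∈ X × v1 ∈ X × Ed v0 v1 × f v0 v1 ≡ c2

SetEq : ∀ {n} → Subset n → (Fin n → Set) → Set
SetEq A P = ∀ v → (v ∈ A) ⇔ P v

PairSetEq : ∀ {n} → PairSet n → (Fin n → Fin n → Set) → Set
PairSetEq R P = ∀ u w → ((u , w) ∈₂ R) ⇔ P u w

-- (c1,c2) ∈ CL_f((A^(j))_j), where f colors the edge set Ed, on the bag X
InCL : ∀ {n c} → Subset n → (Fin n → Fin n → Set) → (Fin n → Fin n → Fin c) →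
       Tuple n → Fin c → Fin c → Set
InCL X Ed f A c1 c2 =
  SetEq (a1 A) (N1 X Ed f c1 c2) × SetEq (a2 A) (N2 X Ed f c1 c2) ×
  PairSetEq (a3 A) (N3 X Ed f c1 c2) ×
  SetEq (a4 A) (N4 X Ed f c1 c2) × SetEq (a5 A) (N5 X Ed f c1 c2) ×
  SetEq (a6 A) (N6 X Ed f c1 c2) × SetEq (a7 A) (N7 X Ed f c1 c2) ×
  PairSetEq (a8 A) (N8 X Ed f c1 c2) × PairSetEq (a9 A) (N9 X Ed f c1 c2)

module _ {n : ℕ} where

  Bar1 : Tuple n → Tuple n → Fin n → Set
  Bar1 L R v0 = (∃ λ v1 → (v0 , v1) ∈₂ a8 L × v1 ∈ a7 R)
              ⊎ (∃ λ v1 → (v0 , v1) ∈₂ a8 R × v1 ∈ a7 L)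

  Bar2 : Tuple n → Tuple n → Fin n → Set
  Bar2 L R v0 = (∃ λ v1 → (v0 , v1) ∈₂ a9 L × v1 ∈ a6 R)
              ⊎ (∃ λ v1 → (v0 , v1) ∈₂ a9 R × v1 ∈ a6 L)

  Bar3 : Tuple n → Tuple n → Fin n → Fin n → Set
  Bar3 L R v1 v2 = (∃ λ v3 → (v1 , v3) ∈₂ a8 L × (v3 , v2) ∈₂ a9 R)
                 ⊎ (∃ λ v3 → (v1 , v3) ∈₂ a8 R × (v3 , v2) ∈₂ a9 L)

  Half4 : Tuple n → Tuple n → Fin n → Set
  Half4 L R v0 = (∃ λ v1 → (v0 , v1) ∈₂ a3 L × v1 ∈ a6 R)
               ⊎ (∃₂ λ v1 v2 → (v0 , v1) ∈₂ a8 L × (v1 , v2) ∈₂ a9 R × v2 ∈ a6 L)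
               ⊎ (∃ λ v1 → (v0 , v1) ∈₂ a8 L × v1 ∈ a2 R)

  Bar4 : Tuple n → Tuple n → Fin n → Set
  Bar4 L R v0 = Half4 L R v0 ⊎ Half4 R L v0

  Half5 : Tuple n → Tuple n → Fin n → Set
  Half5 L R v0 = (∃ λ v1 → (v1 , v0) ∈₂ a3 L × v1 ∈ a7 R)
               ⊎ (∃₂ λ v1 v2 → (v0 , v1) ∈₂ a9 L × (v1 , v2) ∈₂ a8 R × v2 ∈ a7 L)
               ⊎ (∃ λ v1 → (v0 , v1) ∈₂ a9 L × v1 ∈ a1 R)

  Bar5 : Tuple n → Tuple n → Fin n → Set
  Bar5 L R v0 = Half5 L R v0 ⊎ Half5 R L v0

  Empty1 : Fin n → Set
  Empty1 _ = ⊥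

  Empty2 : Fin n → Fin n → Set
  Empty2 _ _ = ⊥

  CombEq : Subset n → Subset n → Subset n → (Fin n → Set) → Fin n → Set
  CombEq A AL AR B v'' = ∀ v → (v ∈ A) ⇔ ((v ∈ AL ⊎ v ∈ AR ⊎ B v) × v ≢ v'')

  CombEq₂ : PairSet n → PairSet n → PairSet n → (Fin n → Fin n → Set) → Fin n → Set
  CombEq₂ A AL AR B v'' = ∀ u w → ((u , w) ∈₂ A) ⇔
    (((u , w) ∈₂ AL ⊎ (u , w) ∈₂ AR ⊎ B u w) × u ≢ v'' × w ≢ v'')

  Combines : Fin n → Tuple n → Tuple n → Tuple n → Set
  Combines v'' A L R =
    CombEq  (a1 A) (a1 L) (a1 R) (Bar1 L R) v'' ×
    CombEq  (a2 A) (a2 L) (a2 R) (Bar2 L R) v'' ×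
    CombEq₂ (a3 A) (a3 L) (a3 R) (Bar3 L R) v'' ×
    CombEq  (a4 A) (a4 L) (a4 R) (Bar4 L R) v'' ×
    CombEq  (a5 A) (a5 L) (a5 R) (Bar5 L R) v'' ×
    CombEq  (a6 A) (a6 L) (a6 R) Empty1 v'' ×
    CombEq  (a7 A) (a7 L) (a7 R) Empty1 v'' ×
    CombEq₂ (a8 A) (a8 L) (a8 R) Empty2 v'' ×
    CombEq₂ (a9 A) (a9 L) (a9 R) Empty2 v''

-- Every walk of length at most three in G_i' = G_L' ∪ G_R' splits into maximal
-- pieces lying in G_L' or in G_R'.  At a vertex where the walk switches sides
-- it meets edges of both subtrees, so by the path property of the
-- decomposition that vertex lies in X_L ∩ X_R; hence each piece is recorded in
-- the colour classes of f_L or f_R, and the sets Ā^(j) are exactly the ways of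
-- gluing such pieces.  Conversely glued pieces are walks of G_i'.  Removing v''
-- accounts for X_i = (X_L ∪ X_R) − {v''}.  The classes j = 2, 5, 7, 9 are the
-- classes j = 1, 4, 6, 8 with the two colours interchanged, so only the latter
-- need a case analysis.
module Submission where

open import Defs
open import Data.Nat using (ℕ)
open import Data.Fin using (Fin)
open import Data.Fin.Subset using (Subset; _∈_; _∉_; _⊆_)
open import Data.Fin.Subset.Properties using (_∈?_; x∈p∩q⁺)
open import Data.Fin.Properties using (any?; _≟_)
open import Data.Bool using (true)
import Data.Bool.Properties as Bool
open import Data.Vec using (tabulate)
open import Data.Vec.Properties using (lookup∘tabulate; lookup⇒[]=; []=⇒lookup)
open import Data.Product using (Σ; ∃; ∃₂; _×_; _,_; proj₁; proj₂; map₂)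
open import Data.Product.Function.NonDependent.Propositional using (_×-⇔_)
open import Data.Sum using (_⊎_; inj₁; inj₂; [_,_]′)
open import Function using (id; _∘_)
open import Function.Bundles using (_⇔_; mk⇔; Equivalence)
open import Function.Properties.Equivalence using () renaming (sym to ⇔-sym; trans to ⇔-trans)
open import Relation.Binary.Core using (_⇒_)
open import Relation.Binary.Definitions using (DecidableEquality; Decidable)
open import Relation.Binary.PropositionalEquality
  using (_≡_; _≢_; refl; cong; trans; subst) renaming (sym to ≡-sym)
open import Relation.Nullary using (Dec; yes; no)
open import Relation.Nullary.Decidable using (map′; decidable-stable; _×-dec_; _⊎-dec_; isYes; toWitness; fromWitness)

open Equivalence using (to; from)

module _ {n : ℕ} where

  ⊑-trans-identityˡ : ∀ {s t : Tree n} (w : s ⊑ t) → ⊑-trans here w ≡ w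
  ⊑-trans-identityˡ here    = refl
  ⊑-trans-identityˡ (inL w) = cong inL (⊑-trans-identityˡ w)
  ⊑-trans-identityˡ (inR w) = cong inR (⊑-trans-identityˡ w)

  ⊑-trans-assoc : ∀ {a b c d : Tree n} (p : a ⊑ b) (q : b ⊑ c) (r : c ⊑ d) →
                  ⊑-trans (⊑-trans p q) r ≡ ⊑-trans p (⊑-trans q r)
  ⊑-trans-assoc p q here    = refl
  ⊑-trans-assoc p q (inL r) = cong inL (⊑-trans-assoc p q r)
  ⊑-trans-assoc p q (inR r) = cong inR (⊑-trans-assoc p q r)

  ≼-refl : ∀ {t : Tree n} {a : Node t} → a ≼ a
  ≼-refl {a = _ , w} = here , ⊑-trans-identityˡ w

  ≼-trans : ∀ {t : Tree n} {a b c : Node t} → a ≼ b → b ≼ c → a ≼ c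
  ≼-trans {a = _ , wa} (o₁ , e₁) (o₂ , e₂) =
    ⊑-trans o₂ o₁ , trans (⊑-trans-assoc o₂ o₁ wa) (trans (cong (⊑-trans o₂) e₁) e₂)

  ≼-childL : ∀ {t : Tree n} {X l r} (w : node X l r ⊑ t) → (node X l r , w) ≼ (l , childL w)
  ≼-childL w = inL here , refl

  ≼-childR : ∀ {t : Tree n} {X l r} (w : node X l r ⊑ t) → (node X l r , w) ≼ (r , childR w)
  ≼-childR w = inR here , refl

  inL-injective : ∀ {s l r : Tree n} {X} {p q : s ⊑ l} → inL {X = X} {r = r} p ≡ inL q → p ≡ q
  inL-injective refl = refl

  inR-injective : ∀ {s l r : Tree n} {X} {p q : s ⊑ r} → inR {X = X} {l = l} p ≡ inR q → p ≡ q
  inR-injective refl = refl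

  ⊑-lca : ∀ {t z a b l r : Tree n} {X} (w : node X l r ⊑ t) (wz : z ⊑ t)
          (o₁ : a ⊑ z) (oa : a ⊑ l) (o₂ : b ⊑ z) (ob : b ⊑ r) →
          ⊑-trans o₁ wz ≡ ⊑-trans (inL oa) w → ⊑-trans o₂ wz ≡ ⊑-trans (inR ob) w →
          Σ (node X l r ⊑ z) λ o → ⊑-trans o wz ≡ w
  ⊑-lca w       here     _  _  _  _  _  _  = w , refl
  ⊑-lca here    (inL wz) _  _  _  _  _  ()
  ⊑-lca here    (inR wz) _  _  _  _  () _
  ⊑-lca (inL w) (inR wz) _  _  _  _  () _
  ⊑-lca (inR w) (inL wz) _  _  _  _  () _
  ⊑-lca (inL w) (inL wz) o₁ oa o₂ ob e₁ e₂ =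
    map₂ (cong inL) (⊑-lca w wz o₁ oa o₂ ob (inL-injective e₁) (inL-injective e₂))
  ⊑-lca (inR w) (inR wz) o₁ oa o₂ ob e₁ e₂ =
    map₂ (cong inR) (⊑-lca w wz o₁ oa o₂ ob (inR-injective e₁) (inR-injective e₂))

  ≼-lca : ∀ {t : Tree n} {X l r} (w : node X l r ⊑ t) {a b z : Node t} →
          (l , childL w) ≼ a → (r , childR w) ≼ b → z ≼ a → z ≼ b → z ≼ (node X l r , w)
  ≼-lca w (oa , ea) (ob , eb) (o₁ , e₁) (o₂ , e₂) =
    ⊑-lca w _ o₁ oa o₂ ob (trans e₁ (trans (≡-sym ea) (≡-sym (⊑-trans-assoc oa (inL here) w))))
                          (trans e₂ (trans (≡-sym eb) (≡-sym (⊑-trans-assoc ob (inR here) w))))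

  _≟ᴺ_ : ∀ {t : Tree n} → DecidableEquality (Node t)
  (_ , here)  ≟ᴺ (_ , here)  = yes refl
  (_ , here)  ≟ᴺ (_ , inL _) = no λ ()
  (_ , here)  ≟ᴺ (_ , inR _) = no λ ()
  (_ , inL _) ≟ᴺ (_ , here)  = no λ ()
  (_ , inR _) ≟ᴺ (_ , here)  = no λ ()
  (_ , inL _) ≟ᴺ (_ , inR _) = no λ ()
  (_ , inR _) ≟ᴺ (_ , inL _) = no λ ()
  (s , inL p) ≟ᴺ (s′ , inL q) = map′ (λ { refl → refl }) (λ { refl → refl }) ((s , p) ≟ᴺ (s′ , q))
  (s , inR p) ≟ᴺ (s′ , inR q) = map′ (λ { refl → refl }) (λ { refl → refl }) ((s , p) ≟ᴺ (s′ , q))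

module _ {n : ℕ} {G : Graph n} {t : Tree n} (ρ : Rep G t) where

  E'-sym : ∀ s (ws : s ⊑ t) {u v} → E' ρ s ws u v → E' ρ s ws v u
  E'-sym (leaf X)     ws (e , q) = trans (Graph.sym G _ _) e , trans (≡-sym (repSym ρ _ _ e)) q
  E'-sym (node X l r) ws (inj₁ e) = inj₁ (E'-sym l _ e)
  E'-sym (node X l r) ws (inj₂ e) = inj₂ (E'-sym r _ e)

  E'-dec : ∀ s (ws : s ⊑ t) → Decidable (E' ρ s ws)
  E'-dec (leaf X)     ws u v = (adj G u v Bool.≟ true) ×-dec (rep ρ u v ≟ᴺ (leaf X , ws))
  E'-dec (node X l r) ws u v = E'-dec l _ u v ⊎-dec E'-dec r _ u v

  E'⇒∈bag-below : ∀ s (ws : s ⊑ t) {u v} → E' ρ s ws u v → ∃ λ a → (s , ws) ≼ a × u ∈ bag a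
  E'⇒∈bag-below (leaf X) ws (e , q) =
    (leaf X , ws) , ≼-refl , subst (λ a → _ ∈ bag a) q (proj₁ (repBag ρ _ _ e))
  E'⇒∈bag-below (node X l r) ws (inj₁ e) =
    let (a , la , ua) = E'⇒∈bag-below l _ e in a , ≼-trans (≼-childL ws) la , ua
  E'⇒∈bag-below (node X l r) ws (inj₂ e) =
    let (a , ra , ua) = E'⇒∈bag-below r _ e in a , ≼-trans (≼-childR ws) ra , ua

  module _ (TD : IsTreeDecomposition G t) {X l r} (w : node X l r ⊑ t) where
    open IsTreeDecomposition TD

    E'ʳ-∈root : ∀ {u v} → E' ρ r (childR w) u v → u ∈ X → u ∈ root r
    E'ʳ-∈root e uX =
      let (a , ra , ua) = E'⇒∈bag-below r _ e
      in path (node X l r , w) a (r , childR w)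
              (inj₂ ra , λ z zw _ → ≼-trans zw (≼-childR w)) (x∈p∩q⁺ (uX , ua))

    E'ˡʳ-∈X : ∀ {u v v′} → E' ρ l (childL w) u v → E' ρ r (childR w) u v′ → u ∈ X
    E'ˡʳ-∈X e e′ =
      let (a , la , ua) = E'⇒∈bag-below l _ e ; (b , rb , ub) = E'⇒∈bag-below r _ e′
      in path a b (node X l r , w)
              (inj₁ (≼-trans (≼-childL w) la) , λ z za zb → ≼-lca w la rb za zb) (x∈p∩q⁺ (ua , ub))

module _ {n : ℕ} where

  subsetOf : {P : Fin n → Set} → (∀ v → Dec (P v)) → Subset n
  subsetOf P? = tabulate (isYes ∘ P?)

  ∈-subsetOf : {P : Fin n → Set} (P? : ∀ v → Dec (P v)) → ∀ v → v ∈ subsetOf P? ⇔ P v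
  ∈-subsetOf P? v = mk⇔
    (λ m → toWitness (from Bool.T-≡ (trans (≡-sym (lookup∘tabulate _ v)) ([]=⇒lookup m))))
    (λ p → lookup⇒[]= v _ (trans (lookup∘tabulate _ v) (to Bool.T-≡ (fromWitness p))))

  subsetOf-⊆ : ∀ {P : Fin n → Set} (P? : ∀ v → Dec (P v)) {X} → (∀ {v} → P v → v ∈ X) → subsetOf P? ⊆ X
  subsetOf-⊆ P? P⊆X m = P⊆X (to (∈-subsetOf P? _) m)

  pairsOf : {R : Fin n → Fin n → Set} → Decidable R → PairSet n
  pairsOf R? = tabulate (λ u → subsetOf (R? u))

  ∈₂-pairsOf : {R : Fin n → Fin n → Set} (R? : Decidable R) → ∀ u w → (u , w) ∈₂ pairsOf R? ⇔ R u w
  ∈₂-pairsOf R? u w rewrite lookup∘tabulate (λ u → subsetOf (R? u)) u = ∈-subsetOf (R? u) w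

  pairsOf-in : ∀ {R : Fin n → Fin n → Set} (R? : Decidable R) {X} →
               (∀ {u w} → R u w → u ∈ X × w ∈ X) → PairsIn (pairsOf R?) X
  pairsOf-in R? R⊆X² u w m = R⊆X² (to (∈₂-pairsOf R? u w) m)

module _ {n c : ℕ} {f : Fin n → Fin n → Fin c} {a b : Fin c}
         {X X′ : Subset n} {Ed Ed′ : Fin n → Fin n → Set} where

  N1-mono : ∀ {v} → (v ∈ X → v ∈ X′) → Ed ⇒ Ed′ → N1 X Ed f a b v → N1 X′ Ed′ f a b v
  N1-mono h ι (x , v1 , v2 , e1 , e2 , p , q) = h x , v1 , v2 , ι e1 , ι e2 , p , q

  N3-mono : ∀ {u w} → (u ∈ X → u ∈ X′) → (w ∈ X → w ∈ X′) → Ed ⇒ Ed′ →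
            N3 X Ed f a b u w → N3 X′ Ed′ f a b u w
  N3-mono hu hw ι (xu , xw , v , e1 , e2 , p , q) = hu xu , hw xw , v , ι e1 , ι e2 , p , q

  N4-mono : ∀ {v} → (v ∈ X → v ∈ X′) → Ed ⇒ Ed′ → N4 X Ed f a b v → N4 X′ Ed′ f a b v
  N4-mono h ι (x , v1 , v2 , v3 , e1 , e2 , e3 , p , q , r) =
    h x , v1 , v2 , v3 , ι e1 , ι e2 , ι e3 , p , q , r

N3-reverse : ∀ {n c} {X : Subset n} {Ed : Fin n → Fin n → Set} {f : Fin n → Fin n → Fin c} →
             (∀ u v → f u v ≡ f v u) → (∀ {u v} → Ed u v → Ed v u) →
             ∀ {a b u w} → N3 X Ed f a b u w → N3 X Ed f b a w u
N3-reverse f-sym Ed-sym {w = w} (xu , xw , v , e1 , e2 , p , q) =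
  xw , xu , v , Ed-sym e2 , Ed-sym e1 , trans (f-sym w v) q , trans (f-sym v _) p

module _ {n c : ℕ} (X : Subset n) {Ed : Fin n → Fin n → Set} (Ed? : Decidable Ed)
         (f : Fin n → Fin n → Fin c) where

  N1? : ∀ a b v0 → Dec (N1 X Ed f a b v0)
  N1? a b v0 = (v0 ∈? X) ×-dec any? λ v1 → any? λ v2 →
               Ed? v0 v1 ×-dec Ed? v1 v2 ×-dec (f v0 v1 ≟ a) ×-dec (f v1 v2 ≟ b)

  N3? : ∀ a b v0 v2 → Dec (N3 X Ed f a b v0 v2)
  N3? a b v0 v2 = (v0 ∈? X) ×-dec (v2 ∈? X) ×-dec any? λ v1 →
                  Ed? v0 v1 ×-dec Ed? v1 v2 ×-dec (f v0 v1 ≟ a) ×-dec (f v1 v2 ≟ b)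

  N4? : ∀ a b v0 → Dec (N4 X Ed f a b v0)
  N4? a b v0 = (v0 ∈? X) ×-dec any? λ v1 → any? λ v2 → any? λ v3 →
               Ed? v0 v1 ×-dec Ed? v1 v2 ×-dec Ed? v2 v3 ×-dec
               (f v0 v1 ≟ a) ×-dec (f v1 v2 ≟ b) ×-dec (f v2 v3 ≟ a)

  N6? : ∀ a b v0 → Dec (N6 X Ed f a b v0)
  N6? a _ v0 = (v0 ∈? X) ×-dec any? λ v → Ed? v0 v ×-dec (f v0 v ≟ a)

  N8? : ∀ a b v0 v1 → Dec (N8 X Ed f a b v0 v1)
  N8? a _ v0 v1 = (v0 ∈? X) ×-dec (v1 ∈? X) ×-dec Ed? v0 v1 ×-dec (f v0 v1 ≟ a)

  module Realisation (c1 c2 : Fin c) where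

    N-tuple : Tuple n
    N-tuple = tuple (subsetOf (N1? c1 c2)) (subsetOf (N1? c2 c1)) (pairsOf (N3? c1 c2))
                    (subsetOf (N4? c1 c2)) (subsetOf (N4? c2 c1))
                    (subsetOf (N6? c1 c2)) (subsetOf (N6? c2 c1))
                    (pairsOf (N8? c1 c2)) (pairsOf (N8? c2 c1))

    N-tuple-InCL : InCL X Ed f N-tuple c1 c2
    N-tuple-InCL = ∈-subsetOf (N1? c1 c2) , ∈-subsetOf (N1? c2 c1) , ∈₂-pairsOf (N3? c1 c2) ,
                   ∈-subsetOf (N4? c1 c2) , ∈-subsetOf (N4? c2 c1) ,
                   ∈-subsetOf (N6? c1 c2) , ∈-subsetOf (N6? c2 c1) ,
                   ∈₂-pairsOf (N8? c1 c2) , ∈₂-pairsOf (N8? c2 c1)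

    N-tuple-InS : InS X N-tuple
    N-tuple-InS = subsetOf-⊆ (N1? c1 c2) proj₁ , subsetOf-⊆ (N1? c2 c1) proj₁ ,
                  pairsOf-in (N3? c1 c2) ends ,
                  subsetOf-⊆ (N4? c1 c2) proj₁ , subsetOf-⊆ (N4? c2 c1) proj₁ ,
                  subsetOf-⊆ (N6? c1 c2) proj₁ , subsetOf-⊆ (N6? c2 c1) proj₁ ,
                  pairsOf-in (N8? c1 c2) ends , pairsOf-in (N8? c2 c1) ends
      where
      ends : ∀ {A : Set} {u w} → u ∈ X × w ∈ X × A → u ∈ X × w ∈ X
      ends (xu , xw , _) = xu , xw

-- InCL with the tuple components replaced by arbitrary predicates, which unlike
-- subsets can be permuted and transposed (see swapColours).
record Classes {n c : ℕ} (X : Subset n) (Ed : Fin n → Fin n → Set)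
               (f : Fin n → Fin n → Fin c) (c1 c2 : Fin c) : Set₁ where
  field
    A1 : Fin n → Set
    A1⇒N1 : ∀ {v} → A1 v → N1 X Ed f c1 c2 v
    N1⇒A1 : ∀ {v} → N1 X Ed f c1 c2 v → A1 v
    A2 : Fin n → Set
    A2⇒N2 : ∀ {v} → A2 v → N2 X Ed f c1 c2 v
    N2⇒A2 : ∀ {v} → N2 X Ed f c1 c2 v → A2 v
    A3 : Fin n → Fin n → Set
    A3⇒N3 : ∀ {u w} → A3 u w → N3 X Ed f c1 c2 u w
    N3⇒A3 : ∀ {u w} → N3 X Ed f c1 c2 u w → A3 u w
    A4 : Fin n → Set
    A4⇒N4 : ∀ {v} → A4 v → N4 X Ed f c1 c2 v
    N4⇒A4 : ∀ {v} → N4 X Ed f c1 c2 v → A4 v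
    A5 : Fin n → Set
    A5⇒N5 : ∀ {v} → A5 v → N5 X Ed f c1 c2 v
    N5⇒A5 : ∀ {v} → N5 X Ed f c1 c2 v → A5 v
    A6 : Fin n → Set
    A6⇒N6 : ∀ {v} → A6 v → N6 X Ed f c1 c2 v
    N6⇒A6 : ∀ {v} → N6 X Ed f c1 c2 v → A6 v
    A7 : Fin n → Set
    A7⇒N7 : ∀ {v} → A7 v → N7 X Ed f c1 c2 v
    N7⇒A7 : ∀ {v} → N7 X Ed f c1 c2 v → A7 v
    A8 : Fin n → Fin n → Set
    A8⇒N8 : ∀ {u w} → A8 u w → N8 X Ed f c1 c2 u w
    N8⇒A8 : ∀ {u w} → N8 X Ed f c1 c2 u w → A8 u w
    A9 : Fin n → Fin n → Set
    A9⇒N9 : ∀ {u w} → A9 u w → N9 X Ed f c1 c2 u w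
    N9⇒A9 : ∀ {u w} → N9 X Ed f c1 c2 u w → A9 u w
open Classes

module _ {n c : ℕ} {X : Subset n} {Ed : Fin n → Fin n → Set} {f : Fin n → Fin n → Fin c} where

  InCL⇒Classes : ∀ {A c1 c2} → InCL X Ed f A c1 c2 → Classes X Ed f c1 c2
  InCL⇒Classes {A} (h1 , h2 , h3 , h4 , h5 , h6 , h7 , h8 , h9) = record
    { A1 = _∈ a1 A ; A1⇒N1 = to (h1 _) ; N1⇒A1 = from (h1 _)
    ; A2 = _∈ a2 A ; A2⇒N2 = to (h2 _) ; N2⇒A2 = from (h2 _)
    ; A3 = λ u w → (u , w) ∈₂ a3 A ; A3⇒N3 = to (h3 _ _) ; N3⇒A3 = from (h3 _ _)
    ; A4 = _∈ a4 A ; A4⇒N4 = to (h4 _) ; N4⇒A4 = from (h4 _)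
    ; A5 = _∈ a5 A ; A5⇒N5 = to (h5 _) ; N5⇒A5 = from (h5 _)
    ; A6 = _∈ a6 A ; A6⇒N6 = to (h6 _) ; N6⇒A6 = from (h6 _)
    ; A7 = _∈ a7 A ; A7⇒N7 = to (h7 _) ; N7⇒A7 = from (h7 _)
    ; A8 = λ u w → (u , w) ∈₂ a8 A ; A8⇒N8 = to (h8 _ _) ; N8⇒A8 = from (h8 _ _)
    ; A9 = λ u w → (u , w) ∈₂ a9 A ; A9⇒N9 = to (h9 _ _) ; N9⇒A9 = from (h9 _ _)
    }

  -- N^(2), N^(5), N^(7), N^(9) are N^(1), N^(4), N^(6), N^(8) with the colours
  -- interchanged, and N^(3) with interchanged colours is the transpose of N^(3).
  swapColours : (∀ u v → f u v ≡ f v u) → (∀ {u v} → Ed u v → Ed v u) →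
                ∀ {c1 c2} → Classes X Ed f c1 c2 → Classes X Ed f c2 c1
  swapColours f-sym Ed-sym C = record
    { A1 = A2 C ; A1⇒N1 = A2⇒N2 C ; N1⇒A1 = N2⇒A2 C
    ; A2 = A1 C ; A2⇒N2 = A1⇒N1 C ; N2⇒A2 = N1⇒A1 C
    ; A3 = λ u w → A3 C w u
    ; A3⇒N3 = N3-reverse f-sym Ed-sym ∘ A3⇒N3 C
    ; N3⇒A3 = N3⇒A3 C ∘ N3-reverse f-sym Ed-sym
    ; A4 = A5 C ; A4⇒N4 = A5⇒N5 C ; N4⇒A4 = N5⇒A5 C
    ; A5 = A4 C ; A5⇒N5 = A4⇒N4 C ; N5⇒A5 = N4⇒A4 C
    ; A6 = A7 C ; A6⇒N6 = A7⇒N7 C ; N6⇒A6 = N7⇒A7 C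
    ; A7 = A6 C ; A7⇒N7 = A6⇒N6 C ; N7⇒A7 = N6⇒A6 C
    ; A8 = A9 C ; A8⇒N8 = A9⇒N9 C ; N8⇒A8 = N9⇒A9 C
    ; A9 = A8 C ; A9⇒N9 = A8⇒N8 C ; N9⇒A9 = N8⇒A8 C
    }

-- The halves of Ā^(1), Ā^(3), Ā^(4): walks starting in the side S that switch to the side T.
module _ {n c : ℕ} {f : Fin n → Fin n → Fin c} {a b : Fin c} {XS XT : Subset n}
         {ES ET : Fin n → Fin n → Set} (S : Classes XS ES f a b) (T : Classes XT ET f a b) where

  Cross1 : Fin n → Set
  Cross1 v0 = ∃ λ v1 → A8 S v0 v1 × A7 T v1

  Cross3 : Fin n → Fin n → Set
  Cross3 v0 v2 = ∃ λ v1 → A8 S v0 v1 × A9 T v1 v2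

  Cross4 : Fin n → Set
  Cross4 v0 = (∃ λ v2 → A3 S v0 v2 × A6 T v2)
            ⊎ (∃₂ λ v1 v2 → A8 S v0 v1 × A9 T v1 v2 × A6 S v2)
            ⊎ (∃ λ v1 → A8 S v0 v1 × A2 T v1)

  module _ {X : Subset n} {E : Fin n → Fin n → Set} (ιS : ES ⇒ E) (ιT : ET ⇒ E) where

    Cross1⇒N1 : ∀ {v0} → (v0 ∈ XS → v0 ∈ X) → Cross1 v0 → N1 X E f a b v0
    Cross1⇒N1 h (v1 , m8 , m7) =
      let (x0 , _ , e1 , p) = A8⇒N8 S m8 ; (_ , v2 , e2 , q) = A7⇒N7 T m7
      in h x0 , v1 , v2 , ιS e1 , ιT e2 , p , q

    Cross3⇒N3 : ∀ {v0 v2} → (v0 ∈ XS → v0 ∈ X) → (v2 ∈ XT → v2 ∈ X) →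
                Cross3 v0 v2 → N3 X E f a b v0 v2
    Cross3⇒N3 h0 h2 (v1 , m8 , m9) =
      let (x0 , _ , e1 , p) = A8⇒N8 S m8 ; (_ , x2 , e2 , q) = A9⇒N9 T m9
      in h0 x0 , h2 x2 , v1 , ιS e1 , ιT e2 , p , q

    Cross4⇒N4 : ∀ {v0} → (v0 ∈ XS → v0 ∈ X) → Cross4 v0 → N4 X E f a b v0
    Cross4⇒N4 h (inj₁ (v2 , m3 , m6)) =
      let (x0 , _ , v1 , e1 , e2 , p , q) = A3⇒N3 S m3 ; (_ , v3 , e3 , r) = A6⇒N6 T m6
      in h x0 , v1 , v2 , v3 , ιS e1 , ιS e2 , ιT e3 , p , q , r
    Cross4⇒N4 h (inj₂ (inj₁ (v1 , v2 , m8 , m9 , m6))) =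
      let (x0 , _ , e1 , p) = A8⇒N8 S m8 ; (_ , _ , e2 , q) = A9⇒N9 T m9
          (_ , v3 , e3 , r) = A6⇒N6 S m6
      in h x0 , v1 , v2 , v3 , ιS e1 , ιT e2 , ιS e3 , p , q , r
    Cross4⇒N4 h (inj₂ (inj₂ (v1 , m8 , m2))) =
      let (x0 , _ , e1 , p) = A8⇒N8 S m8 ; (_ , v2 , v3 , e2 , e3 , q , r) = A2⇒N2 T m2
      in h x0 , v1 , v2 , v3 , ιS e1 , ιT e2 , ιT e3 , p , q , r

module _ {n : ℕ} where

  SetEq-⇔ : ∀ {S : Subset n} {P Q : Fin n → Set} → (∀ v → P v ⇔ Q v) → SetEq S P ⇔ SetEq S Q
  SetEq-⇔ P⇔Q = mk⇔ (λ S≐P v → ⇔-trans (S≐P v) (P⇔Q v)) (λ S≐Q v → ⇔-trans (S≐Q v) (⇔-sym (P⇔Q v)))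

  PairSetEq-⇔ : ∀ {S : PairSet n} {P Q : Fin n → Fin n → Set} →
                (∀ u w → P u w ⇔ Q u w) → PairSetEq S P ⇔ PairSetEq S Q
  PairSetEq-⇔ P⇔Q = mk⇔ (λ S≐P u w → ⇔-trans (S≐P u w) (P⇔Q u w))
                        (λ S≐Q u w → ⇔-trans (S≐Q u w) (⇔-sym (P⇔Q u w)))

module Gluing {n c : ℕ} {X XR : Subset n} {EL ER : Fin n → Fin n → Set}
  {f : Fin n → Fin n → Fin c} {v'' : Fin n}
  (f-sym : ∀ u v → f u v ≡ f v u)
  (EL-sym : ∀ {u v} → EL u v → EL v u) (ER-sym : ∀ {u v} → ER u v → ER v u)
  (v''∉X : v'' ∉ X) (XR⊆X : ∀ {v} → v ≢ v'' → v ∈ XR → v ∈ X)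
  (ER-∈XR : ∀ {u v} → ER u v → u ∈ X → u ∈ XR)
  (EL∩ER⊆X : ∀ {u v w} → EL u v → ER u w → u ∈ X) where

  E : Fin n → Fin n → Set
  E u v = EL u v ⊎ ER u v

  ιL : EL ⇒ E
  ιL = inj₁

  ιR : ER ⇒ E
  ιR = inj₂

  ∈X⇒≢v'' : ∀ {v} → v ∈ X → v ≢ v''
  ∈X⇒≢v'' x refl = v''∉X x

  without-v'' : ∀ {P Q : Fin n → Set} → (∀ {v} → P v → v ∈ X) →
                (∀ {v} → P v → Q v) → (∀ {v} → v ≢ v'' → Q v → P v) →
                ∀ v → P v ⇔ (Q v × v ≢ v'')
  without-v'' P⊆X split join v = mk⇔ (λ p → split p , ∈X⇒≢v'' (P⊆X p)) (λ (q , ne) → join ne q)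

  without-v''₂ : ∀ {P Q : Fin n → Fin n → Set} → (∀ {u w} → P u w → u ∈ X × w ∈ X) →
                 (∀ {u w} → P u w → Q u w) → (∀ {u w} → u ≢ v'' → w ≢ v'' → Q u w → P u w) →
                 ∀ u w → P u w ⇔ (Q u w × u ≢ v'' × w ≢ v'')
  without-v''₂ P⊆X² split join u w = mk⇔
    (λ p → let (xu , xw) = P⊆X² p in split p , ∈X⇒≢v'' xu , ∈X⇒≢v'' xw)
    (λ (q , nu , nw) → join nu nw q)

  ER-∈XR′ : ∀ {u v} → ER u v → v ∈ X → v ∈ XR
  ER-∈XR′ = ER-∈XR ∘ ER-sym

  turnLR : ∀ {u v w} → EL u v → ER v w → v ∈ X × v ∈ XR
  turnLR e e′ = let x = EL∩ER⊆X (EL-sym e) e′ in x , ER-∈XR e′ x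

  turnRL : ∀ {u v w} → ER u v → EL v w → v ∈ X × v ∈ XR
  turnRL e e′ = let x = EL∩ER⊆X e′ (ER-sym e) in x , ER-∈XR′ e x

  module _ {a b : Fin c} (L : Classes X EL f a b) (R : Classes XR ER f a b) where

    Joined1 : Fin n → Set
    Joined1 v = A1 L v ⊎ A1 R v ⊎ Cross1 L R v ⊎ Cross1 R L v

    N1-split : ∀ {v} → N1 X E f a b v → Joined1 v
    N1-split (x0 , v1 , v2 , inj₁ e1 , inj₁ e2 , p , q) =
      inj₁ (N1⇒A1 L (x0 , v1 , v2 , e1 , e2 , p , q))
    N1-split (x0 , v1 , v2 , inj₂ e1 , inj₂ e2 , p , q) =
      inj₂ (inj₁ (N1⇒A1 R (ER-∈XR e1 x0 , v1 , v2 , e1 , e2 , p , q)))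
    N1-split (x0 , v1 , v2 , inj₁ e1 , inj₂ e2 , p , q) =
      let (x1 , y1) = turnLR e1 e2
      in inj₂ (inj₂ (inj₁ (v1 , N8⇒A8 L (x0 , x1 , e1 , p) , N7⇒A7 R (y1 , v2 , e2 , q))))
    N1-split (x0 , v1 , v2 , inj₂ e1 , inj₁ e2 , p , q) =
      let (x1 , y1) = turnRL e1 e2
      in inj₂ (inj₂ (inj₂ (v1 , N8⇒A8 R (ER-∈XR e1 x0 , y1 , e1 , p) , N7⇒A7 L (x1 , v2 , e2 , q))))

    N1-glue : ∀ v → N1 X E f a b v ⇔ (Joined1 v × v ≢ v'')
    N1-glue = without-v'' proj₁ N1-split λ ne →
      [ N1-mono id ιL ∘ A1⇒N1 L
      , [ N1-mono (XR⊆X ne) ιR ∘ A1⇒N1 R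
        , [ Cross1⇒N1 L R ιL ιR id , Cross1⇒N1 R L ιR ιL (XR⊆X ne) ]′ ]′ ]′

    Joined3 : Fin n → Fin n → Set
    Joined3 u w = A3 L u w ⊎ A3 R u w ⊎ Cross3 L R u w ⊎ Cross3 R L u w

    N3-split : ∀ {u w} → N3 X E f a b u w → Joined3 u w
    N3-split (xu , xw , v , inj₁ e1 , inj₁ e2 , p , q) =
      inj₁ (N3⇒A3 L (xu , xw , v , e1 , e2 , p , q))
    N3-split (xu , xw , v , inj₂ e1 , inj₂ e2 , p , q) =
      inj₂ (inj₁ (N3⇒A3 R (ER-∈XR e1 xu , ER-∈XR′ e2 xw , v , e1 , e2 , p , q)))
    N3-split (xu , xw , v , inj₁ e1 , inj₂ e2 , p , q) =
      let (x , y) = turnLR e1 e2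
      in inj₂ (inj₂ (inj₁ (v , N8⇒A8 L (xu , x , e1 , p) , N9⇒A9 R (y , ER-∈XR′ e2 xw , e2 , q))))
    N3-split (xu , xw , v , inj₂ e1 , inj₁ e2 , p , q) =
      let (x , y) = turnRL e1 e2
      in inj₂ (inj₂ (inj₂ (v , N8⇒A8 R (ER-∈XR e1 xu , y , e1 , p) , N9⇒A9 L (x , xw , e2 , q))))

    N3-glue : ∀ u w → N3 X E f a b u w ⇔ (Joined3 u w × u ≢ v'' × w ≢ v'')
    N3-glue = without-v''₂ (λ (xu , xw , _) → xu , xw) N3-split λ nu nw →
      [ N3-mono id id ιL ∘ A3⇒N3 L
      , [ N3-mono (XR⊆X nu) (XR⊆X nw) ιR ∘ A3⇒N3 R
        , [ Cross3⇒N3 L R ιL ιR id (XR⊆X nw) , Cross3⇒N3 R L ιR ιL (XR⊆X nu) id ]′ ]′ ]′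

    Joined4 : Fin n → Set
    Joined4 v = A4 L v ⊎ A4 R v ⊎ Cross4 L R v ⊎ Cross4 R L v

    N4-split : ∀ {v} → N4 X E f a b v → Joined4 v
    N4-split (x0 , v1 , v2 , v3 , inj₁ e1 , inj₁ e2 , inj₁ e3 , p , q , r) =
      inj₁ (N4⇒A4 L (x0 , v1 , v2 , v3 , e1 , e2 , e3 , p , q , r))
    N4-split (x0 , v1 , v2 , v3 , inj₂ e1 , inj₂ e2 , inj₂ e3 , p , q , r) =
      inj₂ (inj₁ (N4⇒A4 R (ER-∈XR e1 x0 , v1 , v2 , v3 , e1 , e2 , e3 , p , q , r)))
    N4-split (x0 , v1 , v2 , v3 , inj₁ e1 , inj₁ e2 , inj₂ e3 , p , q , r) =
      let (x2 , y2) = turnLR e2 e3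
      in inj₂ (inj₂ (inj₁ (inj₁ (v2 , N3⇒A3 L (x0 , x2 , v1 , e1 , e2 , p , q) ,
                                      N6⇒A6 R (y2 , v3 , e3 , r)))))
    N4-split (x0 , v1 , v2 , v3 , inj₁ e1 , inj₂ e2 , inj₁ e3 , p , q , r) =
      let (x1 , y1) = turnLR e1 e2 ; (x2 , y2) = turnRL e2 e3
      in inj₂ (inj₂ (inj₁ (inj₂ (inj₁ (v1 , v2 , N8⇒A8 L (x0 , x1 , e1 , p) ,
                                      N9⇒A9 R (y1 , y2 , e2 , q) , N6⇒A6 L (x2 , v3 , e3 , r))))))
    N4-split (x0 , v1 , v2 , v3 , inj₁ e1 , inj₂ e2 , inj₂ e3 , p , q , r) =
      let (x1 , y1) = turnLR e1 e2
      in inj₂ (inj₂ (inj₁ (inj₂ (inj₂ (v1 , N8⇒A8 L (x0 , x1 , e1 , p) ,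
                                            N2⇒A2 R (y1 , v2 , v3 , e2 , e3 , q , r))))))
    N4-split (x0 , v1 , v2 , v3 , inj₂ e1 , inj₂ e2 , inj₁ e3 , p , q , r) =
      let (x2 , y2) = turnRL e2 e3
      in inj₂ (inj₂ (inj₂ (inj₁ (v2 , N3⇒A3 R (ER-∈XR e1 x0 , y2 , v1 , e1 , e2 , p , q) ,
                                      N6⇒A6 L (x2 , v3 , e3 , r)))))
    N4-split (x0 , v1 , v2 , v3 , inj₂ e1 , inj₁ e2 , inj₂ e3 , p , q , r) =
      let (x1 , y1) = turnRL e1 e2 ; (x2 , y2) = turnLR e2 e3
      in inj₂ (inj₂ (inj₂ (inj₂ (inj₁ (v1 , v2 , N8⇒A8 R (ER-∈XR e1 x0 , y1 , e1 , p) ,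
                                      N9⇒A9 L (x1 , x2 , e2 , q) , N6⇒A6 R (y2 , v3 , e3 , r))))))
    N4-split (x0 , v1 , v2 , v3 , inj₂ e1 , inj₁ e2 , inj₁ e3 , p , q , r) =
      let (x1 , y1) = turnRL e1 e2
      in inj₂ (inj₂ (inj₂ (inj₂ (inj₂ (v1 , N8⇒A8 R (ER-∈XR e1 x0 , y1 , e1 , p) ,
                                            N2⇒A2 L (x1 , v2 , v3 , e2 , e3 , q , r))))))

    N4-glue : ∀ v → N4 X E f a b v ⇔ (Joined4 v × v ≢ v'')
    N4-glue = without-v'' proj₁ N4-split λ ne →
      [ N4-mono id ιL ∘ A4⇒N4 L
      , [ N4-mono (XR⊆X ne) ιR ∘ A4⇒N4 R
        , [ Cross4⇒N4 L R ιL ιR id , Cross4⇒N4 R L ιR ιL (XR⊆X ne) ]′ ]′ ]′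

    Joined6 : Fin n → Set
    Joined6 v = A6 L v ⊎ A6 R v ⊎ Empty1 v

    N6-glue : ∀ v → N6 X E f a b v ⇔ (Joined6 v × v ≢ v'')
    N6-glue = without-v'' proj₁ split join
      where
      split : ∀ {v} → N6 X E f a b v → Joined6 v
      split (x , u , inj₁ e , p) = inj₁ (N6⇒A6 L (x , u , e , p))
      split (x , u , inj₂ e , p) = inj₂ (inj₁ (N6⇒A6 R (ER-∈XR e x , u , e , p)))
      join : ∀ {v} → v ≢ v'' → Joined6 v → N6 X E f a b v
      join _  (inj₁ m)        = let (x , u , e , p) = A6⇒N6 L m in x , u , ιL e , p
      join ne (inj₂ (inj₁ m)) = let (y , u , e , p) = A6⇒N6 R m in XR⊆X ne y , u , ιR e , p

    Joined8 : Fin n → Fin n → Set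
    Joined8 u w = A8 L u w ⊎ A8 R u w ⊎ Empty2 u w

    N8-glue : ∀ u w → N8 X E f a b u w ⇔ (Joined8 u w × u ≢ v'' × w ≢ v'')
    N8-glue = without-v''₂ (λ (xu , xw , _) → xu , xw) split join
      where
      split : ∀ {u w} → N8 X E f a b u w → Joined8 u w
      split (xu , xw , inj₁ e , p) = inj₁ (N8⇒A8 L (xu , xw , e , p))
      split (xu , xw , inj₂ e , p) = inj₂ (inj₁ (N8⇒A8 R (ER-∈XR e xu , ER-∈XR′ e xw , e , p)))
      join : ∀ {u w} → u ≢ v'' → w ≢ v'' → Joined8 u w → N8 X E f a b u w
      join _  _  (inj₁ m)        = let (xu , xw , e , p) = A8⇒N8 L m in xu , xw , ιL e , p
      join nu nw (inj₂ (inj₁ m)) = let (yu , yw , e , p) = A8⇒N8 R m in XR⊆X nu yu , XR⊆X nw yw , ιR e , p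

  InCL-glue : ∀ {A AL AR c1 c2} → InCL X EL f AL c1 c2 → InCL XR ER f AR c1 c2 →
              InCL X E f A c1 c2 ⇔ Combines v'' A AL AR
  InCL-glue {A} {AL} {AR} {c1} {c2} HL HR =
    SetEq-⇔ (N1-glue L R) ×-⇔ SetEq-⇔ (N1-glue L′ R′) ×-⇔ PairSetEq-⇔ {S = a3 A} (N3-glue L R) ×-⇔
    SetEq-⇔ (N4-glue L R) ×-⇔ SetEq-⇔ (N4-glue L′ R′) ×-⇔
    SetEq-⇔ (N6-glue L R) ×-⇔ SetEq-⇔ (N6-glue L′ R′) ×-⇔
    PairSetEq-⇔ {S = a8 A} (N8-glue L R) ×-⇔ PairSetEq-⇔ {S = a9 A} (N8-glue L′ R′)
    where
    L : Classes X EL f c1 c2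
    L = InCL⇒Classes {A = AL} HL
    R : Classes XR ER f c1 c2
    R = InCL⇒Classes {A = AR} HR
    L′ : Classes X EL f c2 c1
    L′ = swapColours f-sym EL-sym L
    R′ : Classes XR ER f c2 c1
    R′ = swapColours f-sym ER-sym R

lemma3p3 : ∀ {n c k : ℕ} (G : Graph n) (t : Tree n) (ρ : Rep G t) →
    IsTreeDecomposition G t → IsSmooth k G t →
    ∀ {X : Subset n} {l r : Tree n} (w : node X l r ⊑ t) →
    root l ≡ X →
    (v' v'' : Fin n) →
    (∀ v → (v ∈ X × v ∉ root r) ⇔ (v ≡ v')) →
    (∀ v → (v ∈ root r × v ∉ X) ⇔ (v ≡ v'')) →
    (f : Fin n → Fin n → Fin c) → (∀ u v → f u v ≡ f v u) →
    (A : Tuple n) → InS X A → (c1 c2 : Fin c) →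
    InCL X (E' ρ (node X l r) w) f A c1 c2
      ⇔ (∃₂ λ (AL AR : Tuple n) → InS (root l) AL × InS (root r) AR ×
           Combines v'' A AL AR ×
           InCL (root l) (E' ρ l (childL w)) f AL c1 c2 ×
           InCL (root r) (E' ρ r (childR w)) f AR c1 c2)
lemma3p3 G t ρ TD _ {l = l} {r} w refl _ v'' _ XR∖X≡v'' f f-sym A _ c1 c2 =
  mk⇔ (λ H → NL.N-tuple , NR.N-tuple , NL.N-tuple-InS , NR.N-tuple-InS ,
             to (InCL-glue {A} {NL.N-tuple} {NR.N-tuple} NL.N-tuple-InCL NR.N-tuple-InCL) H ,
             NL.N-tuple-InCL , NR.N-tuple-InCL)
      (λ (AL , AR , _ , _ , C , HL , HR) → from (InCL-glue {A} {AL} {AR} HL HR) C)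
  where
  module NL = Realisation (root l) (E'-dec ρ l (childL w)) f c1 c2
  module NR = Realisation (root r) (E'-dec ρ r (childR w)) f c1 c2

  v''∉X : v'' ∉ root l
  v''∉X = proj₂ (from (XR∖X≡v'' v'') refl)

  XR⊆X : ∀ {v} → v ≢ v'' → v ∈ root r → v ∈ root l
  XR⊆X {v} v≢v'' v∈XR = decidable-stable (v ∈? root l) λ v∉X → v≢v'' (to (XR∖X≡v'' v) (v∈XR , v∉X))

  open Gluing f-sym (E'-sym ρ l _) (E'-sym ρ r _) v''∉X XR⊆X (E'ʳ-∈root ρ TD w) (E'ˡʳ-∈X ρ TD w)
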